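{- Let $s$ be a positive integer and $E,F$ finite subsets of $\mathbb{Z}^s$ with $\mathcal{O}(E)\subseteq F$. Suppose that $|F|\le \frac{1}{2^{\ell+1}(\ell+1)!}\binom{s}{\ell+2}$ for some integer $\ell$ with $0\le\ell\le s-2$. Then $|F|\ge\frac{s-\ell}{2(\ell+1)}|E|$. More precisely, if $E$ is non-empty, there exist an integer $r\ge 1$, points $\mathbf{x}_1,\dots,\mathbf{x}_r$ of $E$, and partitions $E=E_1\amalg\cdots\amalg E_r$ and $F=F_1\amalg\cdots\amalg F_r\amalg F_{r+1}$ such that for $i=1,\dots,r$: (a) $E_i\subseteq C_\ell(\mathbf{x}_i)$, (b) $F_i\subseteq\mathcal{O}(E_i)$, (c) $|F_i|\ge\frac{s-\ell}{2(\ell+1)}|E_i|$.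
   Context: $(\mathbf{e}_1,\dots,\mathbf{e}_s)$ is the canonical basis of $\mathbb{Z}^s$; $\mathcal{O}(\mathbf{x})=\{\mathbf{x}+\mathbf{e}_1,\dots,\mathbf{x}+\mathbf{e}_s\}$ and $\mathcal{O}(E)=\bigcup_{\mathbf{x}\in E}\mathcal{O}(\mathbf{x})$. $U=\{(x_1,\dots,x_s)\in\mathbb{Z}^s : x_1+\cdots+x_s=0\}$, $\|\mathbf{x}\|_1=|x_1|+\cdots+|x_s|$, $C_k=\{\mathbf{x}\in U:\|\mathbf{x}\|_1\le 2k\}$ and $C_k(\mathbf{x})=\mathbf{x}+C_k$ for integers $k\ge0$. Parts of a partition may be empty. -}

module Defs where

open import Data.Nat as ℕ using (ℕ; _≤_)
open import Data.Integer as ℤ using (ℤ; ∣_∣)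
open import Data.Fin using (Fin)
open import Data.Vec as Vec using (Vec; updateAt; zipWith; foldr)
open import Data.List as List using (List)
open import Data.List.Membership.Propositional using (_∈_)
open import Data.Product using (Σ; ∃; _×_)
open import Relation.Binary.PropositionalEquality using (_≡_)

Pt : ℕ → Set
Pt s = Vec ℤ s

_+e_ : ∀ {s} → Pt s → Fin s → Pt s
x +e i = updateAt x i (ℤ._+ ℤ.1ℤ)

coordSum : ∀ {s} → Pt s → ℤ
coordSum = foldr _ ℤ._+_ ℤ.0ℤ

norm₁ : ∀ {s} → Pt s → ℕ
norm₁ = foldr _ (λ a n → ∣ a ∣ ℕ.+ n) 0

_-ᵥ_ : ∀ {s} → Pt s → Pt s → Pt s
_-ᵥ_ = zipWith ℤ._-_

InU : ∀ {s} → Pt s → Set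
InU y = coordSum y ≡ ℤ.0ℤ

InC : ∀ {s} → ℕ → Pt s → Pt s → Set
InC k x y = InU (y -ᵥ x) × norm₁ (y -ᵥ x) ≤ 2 ℕ.* k

InO : ∀ {s} → List (Pt s) → Pt s → Set
InO {s} E y = Σ (Pt s) λ x → x ∈ E × Σ (Fin s) λ i → y ≡ x +e i

_⊆_ : ∀ {s} → List (Pt s) → (Pt s → Set) → Set
A ⊆ P = ∀ {y} → y ∈ A → P y

-- Fix x ∈ E and let E_k = E ∩ C_k(x). From a point of E_k at most k coordinates of y − x are
-- negative, and a point of F is a unit step from at most k + 1 points of E_k along a
-- coordinate where y − x is nonnegative; double counting gives (s − k)|E_k| ≤ (k + 1)|F ∩ 𝒪(E_k)|.
-- A point of 𝒪(E_k) that also has a predecessor in E ∖ E_k is a unit step from E_{k+1} along a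
-- negative coordinate, so there are at most (k + 1)|E_{k+1}| of them. Let F_k be the points of F
-- all of whose predecessors in E lie in E_k. If (s − ℓ)|E_k| > 2(ℓ + 1)|F_k| for every k ≤ ℓ,
-- these bounds give (s − k)|E_k| < 2(k + 1)²|E_{k+1}|, hence s(s − 1)⋯(s − ℓ) < 2^{ℓ+1}((ℓ + 1)!)²|E_{ℓ+1}|;
-- together with (s − ℓ − 1)|E_{ℓ+1}| ≤ (ℓ + 2)|F| this contradicts the bound on |F|. So some
-- (E_k, F_k) expands; split it off and recurse on E ∖ E_k and F ∖ F_k, which again satisfy
-- 𝒪(E ∖ E_k) ⊆ F ∖ F_k.

module Submission where

open import Defs
open import Data.Nat using (ℕ; _+_; _*_; _∸_; _^_; _≤_; suc; _!)
open import Data.Nat.Combinatorics using (_C_)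
open import Data.Fin using (Fin)
open import Data.Vec as Vec using (Vec; lookup; toList)
open import Data.List using (List; length; concat; _++_; [])
open import Data.List.Membership.Propositional using (_∈_)
open import Data.List.Relation.Unary.Unique.Propositional using (Unique)
open import Data.List.Relation.Binary.Permutation.Propositional using (_↭_)
open import Data.Product using (Σ; _×_)
open import Relation.Binary.PropositionalEquality using (_≢_)

open import Data.Bool using (Bool; true; false; if_then_else_; not; T)
import Data.Bool as Bool
open import Data.Bool.Properties using (not-injective)
open import Data.Empty using (⊥; ⊥-elim)
import Data.Fin as Fin
import Data.Fin.Properties as Fin
open import Data.Integer as ℤ using (ℤ; -[1+_])
import Data.Integer.Properties as ℤ
open import Algebra.Properties.AbelianGroup ℤ.+-0-abelianGroup using (∙-cancelʳ)
open import Algebra.Properties.CommutativeSemigroup ℤ.+-commutativeSemigroup using () renaming (interchange to ℤ+-interchange)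
open import Data.Integer.Tactic.RingSolver using () renaming (solve-∀ to ℤ-solve-∀)
open import Data.List using (_∷_; [_]; map; filter)
open import Data.List.Properties using (length-++; length-++-≤ˡ; length-filter; filter-notAll; length-map; map-cong; ++-assoc)
open import Data.List.Membership.Propositional.Properties using (∈-filter⁺; ∈-filter⁻; ∈-map⁺; ∈-map⁻; ∈-++⁺ʳ)
open import Data.List.Relation.Unary.Any as Any using (here; there)
import Data.List.Relation.Unary.All as All
import Data.List.Relation.Unary.All.Properties as All
open import Data.List.Relation.Unary.AllPairs using ([]; _∷_)
import Data.List.Relation.Unary.Unique.Propositional.Properties as Unique
open import Data.List.Relation.Binary.Permutation.Propositional using (↭-refl; ↭-sym; ↭-trans; ↭-reflexive; prep)
open import Data.List.Relation.Binary.Permutation.Propositional.Properties using (shift; ++⁺ˡ; ∈-resp-↭; ↭-length; ↭-empty-inv)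
import Data.Nat as ℕ
open import Data.Nat using (zero; z≤n; s≤s; _<_; _≤?_; NonZero; >-nonZero)
open import Data.Nat.Combinatorics using (_P_; nCk≡nPk/k!)
open import Data.Nat.Combinatorics.Base using (_P′_)
open import Data.Nat.DivMod using (_/_; m/n*n≤m)
open import Data.Nat.Induction using (<-wellFounded)
open import Data.Nat.ListAction using (sum)
open import Data.Nat.Properties
open import Algebra.Properties.CommutativeSemigroup +-commutativeSemigroup using () renaming (interchange to +-interchange)
open import Data.Nat.Tactic.RingSolver using (solve-∀)
open import Data.Product using (_,_; proj₁; proj₂)
open import Data.Sum using (_⊎_; inj₁; inj₂; [_,_]′)
open import Data.Vec using ([]; _∷_; updateAt)
open import Data.Vec.Properties using (≡-dec; updateAt-updateAt-local; updateAt-id; lookup∘updateAt; lookup∘updateAt′)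
open import Function using (_∘_; id)
open import Induction.WellFounded using (Acc; acc)
open import Relation.Binary using (DecidableEquality)
open import Relation.Binary.PropositionalEquality using (_≡_; refl; sym; trans; cong; cong₂; subst; subst₂; module ≡-Reasoning)
open import Relation.Nullary using (¬_; Dec; yes; no; ¬?)
open import Relation.Nullary.Decidable using (_×-dec_)
open import Relation.Unary using (Pred; Decidable)
open import Relation.Unary.Properties using (∁?)

-- Counting in lists

indicator : ∀ {p} {P : Set p} → Dec P → ℕ
indicator (yes _) = 1
indicator (no _) = 0

module _ {A : Set} where

  _─_ : ∀ {z} (M : List A) → z ∈ M → List A
  (_ ∷ M) ─ here _ = M
  (y ∷ M) ─ there p = y ∷ (M ─ p)

  length-─ : ∀ {z} (M : List A) (p : z ∈ M) → length M ≡ suc (length (M ─ p))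
  length-─ (_ ∷ M) (here _) = refl
  length-─ (_ ∷ M) (there p) = cong suc (length-─ M p)

  ∈-─ : ∀ {z w} (M : List A) (p : z ∈ M) → w ∈ M → w ≢ z → w ∈ M ─ p
  ∈-─ (_ ∷ M) (here refl) (here refl) w≢z = ⊥-elim (w≢z refl)
  ∈-─ (_ ∷ M) (here refl) (there q) _ = q
  ∈-─ (_ ∷ M) (there p) (here refl) _ = here refl
  ∈-─ (_ ∷ M) (there p) (there q) w≢z = there (∈-─ M p q w≢z)

  Unique-⊆⇒length≤ : ∀ {L M : List A} → Unique L → (∀ {z} → z ∈ L → z ∈ M) → length L ≤ length M
  Unique-⊆⇒length≤ {[]} _ _ = z≤n
  Unique-⊆⇒length≤ {z ∷ L} {M} (z∉L ∷ uL) L⊆M =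
    subst (suc (length L) ≤_) (sym (length-─ M z∈M)) (s≤s (Unique-⊆⇒length≤ uL L⊆M─z))
    where
    z∈M : z ∈ M
    z∈M = L⊆M (here refl)
    L⊆M─z : ∀ {w} → w ∈ L → w ∈ M ─ z∈M
    L⊆M─z w∈L = ∈-─ M z∈M (L⊆M (there w∈L)) (λ w≡z → All.lookup z∉L w∈L (sym w≡z))

  module _ {p} {P : Pred A p} (P? : Decidable P) where

    filter-++-filter∁-↭ : ∀ xs → filter P? xs ++ filter (∁? P?) xs ↭ xs
    filter-++-filter∁-↭ [] = ↭-refl
    filter-++-filter∁-↭ (x ∷ xs) with P? x
    ... | yes _ = prep x (filter-++-filter∁-↭ xs)
    ... | no _ = ↭-trans (shift x (filter P? xs) _) (prep x (filter-++-filter∁-↭ xs))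

    length-filter-∷ : ∀ x xs → length (filter P? (x ∷ xs)) ≡ indicator (P? x) + length (filter P? xs)
    length-filter-∷ x xs with P? x
    ... | yes _ = refl
    ... | no _ = refl

    length-filter≡sum : ∀ xs → length (filter P? xs) ≡ sum (map (λ x → indicator (P? x)) xs)
    length-filter≡sum [] = refl
    length-filter≡sum (x ∷ xs) = trans (length-filter-∷ x xs) (cong (indicator (P? x) +_) (length-filter≡sum xs))

  indicator-⊎ : ∀ {p q r} {P : Set p} {Q : Set q} {R : Set r} → (P → Q ⊎ R) →
    (P? : Dec P) (Q? : Dec Q) (R? : Dec R) → indicator P? ≤ indicator Q? + indicator R?
  indicator-⊎ _ (no _) _ _ = z≤n
  indicator-⊎ _ (yes _) (yes _) _ = s≤s z≤n
  indicator-⊎ _ (yes _) (no _) (yes _) = s≤s z≤n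
  indicator-⊎ P⇒Q⊎R (yes p) (no ¬q) (no ¬r) = ⊥-elim ([ ¬q , ¬r ]′ (P⇒Q⊎R p))

  length-filter-⊎ : ∀ {p q r} {P : Pred A p} {Q : Pred A q} {R : Pred A r}
    (P? : Decidable P) (Q? : Decidable Q) (R? : Decidable R) → (∀ {x} → P x → Q x ⊎ R x) →
    ∀ xs → length (filter P? xs) ≤ length (filter Q? xs) + length (filter R? xs)
  length-filter-⊎ P? Q? R? P⇒Q⊎R [] = z≤n
  length-filter-⊎ P? Q? R? P⇒Q⊎R (x ∷ xs) = begin
    length (filter P? (x ∷ xs))                                   ≡⟨ length-filter-∷ P? x xs ⟩
    indicator (P? x) + length (filter P? xs)
      ≤⟨ +-mono-≤ (indicator-⊎ P⇒Q⊎R (P? x) (Q? x) (R? x)) (length-filter-⊎ P? Q? R? P⇒Q⊎R xs) ⟩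
    indicator (Q? x) + indicator (R? x) + (length (filter Q? xs) + length (filter R? xs))
      ≡⟨ +-interchange (indicator (Q? x)) _ _ _ ⟩
    indicator (Q? x) + length (filter Q? xs) + (indicator (R? x) + length (filter R? xs))
      ≡⟨ cong₂ _+_ (length-filter-∷ Q? x xs) (length-filter-∷ R? x xs) ⟨
    length (filter Q? (x ∷ xs)) + length (filter R? (x ∷ xs))    ∎
    where open ≤-Reasoning

  sum-map-+ : (f g : A → ℕ) → ∀ xs → sum (map (λ x → f x + g x) xs) ≡ sum (map f xs) + sum (map g xs)
  sum-map-+ f g [] = refl
  sum-map-+ f g (x ∷ xs) =
    trans (cong (f x + g x +_) (sum-map-+ f g xs)) (+-interchange (f x) (g x) _ _)

  sum-map-≤ : ∀ {n} (f : A → ℕ) xs → (∀ {x} → x ∈ xs → f x ≤ n) → sum (map f xs) ≤ n * length xs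
  sum-map-≤ {n} f [] _ = ≤-reflexive (sym (*-zeroʳ n))
  sum-map-≤ {n} f (x ∷ xs) f≤n = ≤-trans (+-mono-≤ (f≤n (here refl)) (sum-map-≤ f xs (f≤n ∘ there)))
    (≤-reflexive (sym (*-suc n (length xs))))

module _ {A B : Set} {r} {R : A → B → Set r} (R? : ∀ a b → Dec (R a b)) where

  double-counting : ∀ {m n} (X : List A) (Y : List B) →
    (∀ {x} → x ∈ X → m ≤ length (filter (R? x) Y)) →
    (∀ {y} → y ∈ Y → length (filter (λ x → R? x y) X) ≤ n) →
    m * length X ≤ n * length Y
  double-counting {m} {n} X Y lower upper =
    ≤-trans (lower-sum X lower) (sum-map-≤ (λ y → length (filter (λ x → R? x y) X)) Y upper)
    where
    lower-sum : ∀ X → (∀ {x} → x ∈ X → m ≤ length (filter (R? x) Y)) →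
      m * length X ≤ sum (map (λ y → length (filter (λ x → R? x y) X)) Y)
    lower-sum [] _ = ≤-trans (≤-reflexive (*-zeroʳ m)) z≤n
    lower-sum (x ∷ X) lower = begin
      m * suc (length X)                   ≡⟨ *-suc m (length X) ⟩
      m + m * length X                     ≤⟨ +-mono-≤ (lower (here refl)) (lower-sum X (lower ∘ there)) ⟩
      length (filter (R? x) Y) + sum (map (λ y → length (filter (λ x → R? x y) X)) Y)
        ≡⟨ cong (_+ _) (length-filter≡sum (R? x) Y) ⟩
      sum (map (λ y → indicator (R? x y)) Y) + sum (map (λ y → length (filter (λ x → R? x y) X)) Y)
        ≡⟨ sum-map-+ _ _ Y ⟨
      sum (map (λ y → indicator (R? x y) + length (filter (λ x → R? x y) X)) Y)
        ≡⟨ cong sum (map-cong (λ y → length-filter-∷ (λ x → R? x y) x X) Y) ⟨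
      sum (map (λ y → length (filter (λ x → R? x y) (x ∷ X))) Y) ∎
      where open ≤-Reasoning

-- Lattice points

module _ {A : Set} where

  indicesWhere : ∀ {n} → (A → Bool) → Vec A n → List (Fin n)
  indicesWhere p [] = []
  indicesWhere p (a ∷ v) = (if p a then Fin.zero ∷_ else id) (map Fin.suc (indicesWhere p v))

  ∈-indicesWhere⁺ : ∀ {n} p (v : Vec A n) {i} → p (lookup v i) ≡ true → i ∈ indicesWhere p v
  ∈-indicesWhere⁺ p (a ∷ v) {Fin.zero} pa rewrite pa = here refl
  ∈-indicesWhere⁺ p (a ∷ v) {Fin.suc i} pvi with p a
  ... | true = there (∈-map⁺ Fin.suc (∈-indicesWhere⁺ p v pvi))
  ... | false = ∈-map⁺ Fin.suc (∈-indicesWhere⁺ p v pvi)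

  ∈-indicesWhere⁻ : ∀ {n} p (v : Vec A n) {i} → i ∈ indicesWhere p v → p (lookup v i) ≡ true
  ∈-indicesWhere⁻ p (a ∷ v) i∈ with p a in pa
  ∈-indicesWhere⁻ p (a ∷ v) (here refl) | true = pa
  ∈-indicesWhere⁻ p (a ∷ v) (there i∈) | true with _ , j∈ , refl ← ∈-map⁻ Fin.suc i∈ = ∈-indicesWhere⁻ p v j∈
  ∈-indicesWhere⁻ p (a ∷ v) i∈ | false with _ , j∈ , refl ← ∈-map⁻ Fin.suc i∈ = ∈-indicesWhere⁻ p v j∈

  indicesWhere-Unique : ∀ {n} p (v : Vec A n) → Unique (indicesWhere p v)
  indicesWhere-Unique p [] = []
  indicesWhere-Unique p (a ∷ v) with p a
  ... | true = All.map⁺ (All.universal (λ _ ()) _) ∷ Unique.map⁺ Fin.suc-injective (indicesWhere-Unique p v)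
  ... | false = Unique.map⁺ Fin.suc-injective (indicesWhere-Unique p v)

  length-indicesWhere-not : ∀ {n} p (v : Vec A n) → length (indicesWhere p v) + length (indicesWhere (not ∘ p) v) ≡ n
  length-indicesWhere-not p [] = refl
  length-indicesWhere-not p (a ∷ v) with p a
  ... | true rewrite length-map Fin.suc (indicesWhere p v) | length-map Fin.suc (indicesWhere (not ∘ p) v) =
    cong suc (length-indicesWhere-not p v)
  ... | false rewrite length-map Fin.suc (indicesWhere p v) | length-map Fin.suc (indicesWhere (not ∘ p) v) =
    trans (+-suc _ _) (cong suc (length-indicesWhere-not p v))

  length-indicesWhere≤ : ∀ {n} p (w : A → ℕ) → (∀ {a} → p a ≡ true → 1 ≤ w a) →
    (v : Vec A n) → length (indicesWhere p v) ≤ Vec.sum (Vec.map w v)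
  length-indicesWhere≤ p w p⇒1≤w [] = z≤n
  length-indicesWhere≤ p w p⇒1≤w (a ∷ v) with p a in pa
  ... | true rewrite length-map Fin.suc (indicesWhere p v) = +-mono-≤ (p⇒1≤w pa) (length-indicesWhere≤ p w p⇒1≤w v)
  ... | false rewrite length-map Fin.suc (indicesWhere p v) = ≤-trans (length-indicesWhere≤ p w p⇒1≤w v) (m≤n+m _ (w a))

posPart negPart : ℤ → ℕ
posPart (ℤ.+ n) = n
posPart -[1+ _ ] = 0
negPart (ℤ.+ _) = 0
negPart -[1+ n ] = suc n

isNegative isPositive : ℤ → Bool
isNegative (ℤ.+ _) = false
isNegative -[1+ _ ] = true
isPositive (ℤ.+ zero) = false
isPositive (ℤ.+ suc _) = true
isPositive -[1+ _ ] = false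

posSum negSum : ∀ {n} → Vec ℤ n → ℕ
posSum v = Vec.sum (Vec.map posPart v)
negSum v = Vec.sum (Vec.map negPart v)

coordSum+negSum≡posSum : ∀ {n} (v : Vec ℤ n) → coordSum v ℤ.+ (ℤ.+ negSum v) ≡ ℤ.+ posSum v
coordSum+negSum≡posSum [] = refl
coordSum+negSum≡posSum (a ∷ v) = begin
  (a ℤ.+ coordSum v) ℤ.+ (ℤ.+ (negPart a ℕ.+ negSum v))        ≡⟨ cong (λ z → (a ℤ.+ coordSum v) ℤ.+ z) (ℤ.pos-+ (negPart a) (negSum v)) ⟩
  (a ℤ.+ coordSum v) ℤ.+ ((ℤ.+ negPart a) ℤ.+ (ℤ.+ negSum v))  ≡⟨ ℤ+-interchange a (coordSum v) (ℤ.+ negPart a) (ℤ.+ negSum v) ⟩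
  (a ℤ.+ (ℤ.+ negPart a)) ℤ.+ (coordSum v ℤ.+ (ℤ.+ negSum v))  ≡⟨ cong₂ ℤ._+_ (part a) (coordSum+negSum≡posSum v) ⟩
  (ℤ.+ posPart a) ℤ.+ (ℤ.+ posSum v)                           ≡⟨ ℤ.pos-+ (posPart a) (posSum v) ⟨
  ℤ.+ (posPart a ℕ.+ posSum v)                                 ∎
  where
  open ≡-Reasoning
  part : ∀ a → a ℤ.+ (ℤ.+ negPart a) ≡ ℤ.+ posPart a
  part (ℤ.+ n) = ℤ.+-identityʳ (ℤ.+ n)
  part -[1+ n ] = ℤ.+-inverseˡ (ℤ.+ suc n)

norm₁≡posSum+negSum : ∀ {n} (v : Vec ℤ n) → norm₁ v ≡ posSum v ℕ.+ negSum v
norm₁≡posSum+negSum [] = refl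
norm₁≡posSum+negSum (a ∷ v) =
  trans (cong₂ ℕ._+_ (part a) (norm₁≡posSum+negSum v)) (+-interchange (posPart a) (negPart a) (posSum v) (negSum v))
  where
  part : ∀ a → ℤ.∣ a ∣ ≡ posPart a ℕ.+ negPart a
  part (ℤ.+ n) = sym (+-identityʳ n)
  part -[1+ n ] = refl

_-e_ : ∀ {n} → Pt n → Fin n → Pt n
x -e i = updateAt x i (ℤ._+ ℤ.-1ℤ)

-e-+e : ∀ {n} (x : Pt n) (i : Fin n) → (x -e i) +e i ≡ x
-e-+e x i = trans (updateAt-updateAt-local i {h = id} x (trans (ℤ.+-assoc (lookup x i) ℤ.-1ℤ ℤ.1ℤ) (ℤ.+-identityʳ (lookup x i))))
                  (updateAt-id i x)

+e--e : ∀ {n} (x : Pt n) (i : Fin n) → (x +e i) -e i ≡ x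
+e--e x i = trans (updateAt-updateAt-local i {h = id} x (trans (ℤ.+-assoc (lookup x i) ℤ.1ℤ ℤ.-1ℤ) (ℤ.+-identityʳ (lookup x i))))
                  (updateAt-id i x)

+e-injective : ∀ {n} (x : Pt n) {i j : Fin n} → x +e i ≡ x +e j → i ≡ j
+e-injective x {i} {j} xi≡xj with i Fin.≟ j
... | yes i≡j = i≡j
... | no i≢j = ⊥-elim (ℤ.i≢suc[i] (trans (sym xᵢ≡xᵢ+1) (ℤ.+-comm (lookup x i) ℤ.1ℤ)))
  where
  xᵢ≡xᵢ+1 : lookup x i ℤ.+ ℤ.1ℤ ≡ lookup x i
  xᵢ≡xᵢ+1 = trans (sym (lookup∘updateAt i x)) (trans (cong (λ y → lookup y i) xi≡xj) (lookup∘updateAt′ i j i≢j x))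

-ᵥ-+e : ∀ {n} (y x : Pt n) (i : Fin n) → (y +e i) -ᵥ x ≡ (y -ᵥ x) +e i
-ᵥ-+e (a ∷ y) (b ∷ x) Fin.zero = cong (_∷ (y -ᵥ x)) (+1-comm a b)
  where
  +1-comm : ∀ a b → (a ℤ.+ ℤ.1ℤ) ℤ.- b ≡ (a ℤ.- b) ℤ.+ ℤ.1ℤ
  +1-comm = ℤ-solve-∀
-ᵥ-+e (a ∷ y) (b ∷ x) (Fin.suc i) = cong (a ℤ.- b ∷_) (-ᵥ-+e y x i)

coordSum-+e : ∀ {n} (v : Pt n) (i : Fin n) → coordSum (v +e i) ≡ coordSum v ℤ.+ ℤ.1ℤ
coordSum-+e (a ∷ v) Fin.zero = +1-pull a (coordSum v)
  where
  +1-pull : ∀ a c → (a ℤ.+ ℤ.1ℤ) ℤ.+ c ≡ (a ℤ.+ c) ℤ.+ ℤ.1ℤ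
  +1-pull = ℤ-solve-∀
coordSum-+e (a ∷ v) (Fin.suc i) = trans (cong (ℤ._+_ a) (coordSum-+e v i)) (sym (ℤ.+-assoc a (coordSum v) ℤ.1ℤ))

posSum-+e-nonneg : ∀ {n} (v : Pt n) (i : Fin n) → isNegative (lookup v i) ≡ false → posSum (v +e i) ≡ suc (posSum v)
posSum-+e-nonneg (ℤ.+ m ∷ v) Fin.zero _ = cong (_+ posSum v) (+-comm m 1)
posSum-+e-nonneg (a ∷ v) (Fin.suc i) vᵢ≥0 = trans (cong (posPart a +_) (posSum-+e-nonneg v i vᵢ≥0)) (+-suc (posPart a) (posSum v))

posSum-+e-neg : ∀ {n} (v : Pt n) (i : Fin n) → isNegative (lookup v i) ≡ true → posSum (v +e i) ≡ posSum v
posSum-+e-neg (-[1+ zero ] ∷ v) Fin.zero _ = refl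
posSum-+e-neg (-[1+ suc _ ] ∷ v) Fin.zero _ = refl
posSum-+e-neg (a ∷ v) (Fin.suc i) vᵢ<0 = cong (posPart a +_) (posSum-+e-neg v i vᵢ<0)

posSum-+e-≤ : ∀ {n} (v : Pt n) (i : Fin n) → posSum (v +e i) ≤ suc (posSum v)
posSum-+e-≤ v i with isNegative (lookup v i) in vᵢ
... | false = ≤-reflexive (posSum-+e-nonneg v i vᵢ)
... | true = ≤-trans (≤-reflexive (posSum-+e-neg v i vᵢ)) (n≤1+n _)

posSum-≤-+e : ∀ {n} (v : Pt n) (i : Fin n) → posSum v ≤ posSum (v +e i)
posSum-≤-+e v i with isNegative (lookup v i) in vᵢ
... | false = ≤-trans (n≤1+n _) (≤-reflexive (sym (posSum-+e-nonneg v i vᵢ)))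
... | true = ≤-reflexive (sym (posSum-+e-neg v i vᵢ))

isPositive-+e : ∀ {n} (v : Pt n) (i : Fin n) → isNegative (lookup v i) ≡ false → isPositive (lookup (v +e i) i) ≡ true
isPositive-+e v i vᵢ≥0 rewrite lookup∘updateAt i {ℤ._+ ℤ.1ℤ} v = nonneg+1 (lookup v i) vᵢ≥0
  where
  nonneg+1 : ∀ a → isNegative a ≡ false → isPositive (a ℤ.+ ℤ.1ℤ) ≡ true
  nonneg+1 (ℤ.+ m) _ rewrite +-comm m 1 = refl

-- On U the ℓ¹-norm is twice the positive part, so C_k = { z ∈ U : posSum z ≤ k }.
InCᵖ : ∀ {n} → ℕ → Pt n → Set
InCᵖ k z = coordSum z ≡ ℤ.0ℤ × posSum z ≤ k

InCᵖ? : ∀ {n} k (z : Pt n) → Dec (InCᵖ k z)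
InCᵖ? k z = (coordSum z ℤ.≟ ℤ.0ℤ) ×-dec (posSum z ≤? k)

negSum≡posSum : ∀ {n} (z : Pt n) → coordSum z ≡ ℤ.0ℤ → negSum z ≡ posSum z
negSum≡posSum z z∈U = ℤ.+-injective (trans (sym (ℤ.+-identityˡ (ℤ.+ negSum z)))
  (trans (cong (ℤ._+ (ℤ.+ negSum z)) (sym z∈U)) (coordSum+negSum≡posSum z)))

InCᵖ⇒InC : ∀ {n} k (x y : Pt n) → InCᵖ k (y -ᵥ x) → InC k x y
InCᵖ⇒InC {n} k x y (z∈U , p≤k) = z∈U , (begin
  norm₁ z              ≡⟨ norm₁≡posSum+negSum z ⟩
  posSum z + negSum z  ≡⟨ cong (posSum z +_) (negSum≡posSum z z∈U) ⟩
  posSum z + posSum z  ≤⟨ +-mono-≤ p≤k p≤k ⟩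
  k + k                ≡⟨ cong (k +_) (+-identityʳ k) ⟨
  2 * k                ∎)
  where
  z : Pt n
  z = y -ᵥ x
  open ≤-Reasoning

InCᵖ-self : ∀ {n} k (x : Pt n) → InCᵖ k (x -ᵥ x)
InCᵖ-self k [] = refl , z≤n
InCᵖ-self k (a ∷ x) = cong₂ ℤ._+_ (ℤ.+-inverseʳ a) (proj₁ (InCᵖ-self k x))
                    , subst (λ c → posPart c + posSum (x -ᵥ x) ≤ k) (sym (ℤ.+-inverseʳ a)) (proj₂ (InCᵖ-self k x))

#negatives≤posSum : ∀ {n} (z : Pt n) → coordSum z ≡ ℤ.0ℤ → length (indicesWhere isNegative z) ≤ posSum z
#negatives≤posSum z z∈U = ≤-trans (length-indicesWhere≤ isNegative negPart negative⇒1≤negPart z) (≤-reflexive (negSum≡posSum z z∈U))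
  where
  negative⇒1≤negPart : ∀ {c} → isNegative c ≡ true → 1 ≤ negPart c
  negative⇒1≤negPart { -[1+ _ ]} _ = s≤s z≤n

#positives≤posSum : ∀ {n} (z : Pt n) → length (indicesWhere isPositive z) ≤ posSum z
#positives≤posSum = length-indicesWhere≤ isPositive posPart positive⇒1≤posPart
  where
  positive⇒1≤posPart : ∀ {c} → isPositive c ≡ true → 1 ≤ posPart c
  positive⇒1≤posPart {ℤ.+ suc _} _ = s≤s z≤n

-- Choosing the level

nCk*k!≤nP′k : ∀ n k → k ≤ n → (n C k) * k ! ≤ n P′ k
nCk*k!≤nP′k n k k≤n = begin
  (n C k) * k !               ≡⟨ cong (_* k !) (nCk≡nPk/k! k≤n) ⟩
  ((n P k) / k !) * k !       ≡⟨ cong (λ p → (p / k !) * k !) (if-true (≤⇒≤ᵇ k≤n)) ⟩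
  ((n P′ k) / k !) * k !      ≤⟨ m/n*n≤m (n P′ k) (k !) ⟩
  n P′ k                      ∎
  where
  open ≤-Reasoning
  instance _ = k !≢0
  if-true : ∀ {b} → T b → (if b then n P′ k else 0) ≡ n P′ k
  if-true {true} _ = refl

module _ {s ℓ N : ℕ} (core outflow image leak : ℕ → ℕ)
  (outflow-bound : ∀ k → (s ∸ k) * core k ≤ suc k * outflow k)
  (outflow-split : ∀ k → outflow k ≤ image k + leak k)
  (leak-bound : ∀ k → leak k ≤ suc k * core (suc k))
  (outflow≤N : ∀ k → outflow k ≤ N)
  (core₀-nonempty : 1 ≤ core 0)
  (ℓ+2≤s : ℓ + 2 ≤ s)
  (N-small : N * (2 ^ (ℓ + 1) * (ℓ + 1) !) ≤ s C (ℓ + 2))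
  where

  Expands : ℕ → Set
  Expands k = (s ∸ ℓ) * core k ≤ 2 * (ℓ + 1) * image k

  module _ (stalls : ∀ k → k ≤ ℓ → ¬ Expands k) where

    2*image<outflow : ∀ k → k ≤ ℓ → 2 * image k < outflow k
    2*image<outflow k k≤ℓ = *-cancelˡ-< (suc ℓ) (2 * image k) (outflow k) (begin-strict
      suc ℓ * (2 * image k)  ≡⟨ reassoc ℓ (image k) ⟩
      2 * (ℓ + 1) * image k  <⟨ ≰⇒> (stalls k k≤ℓ) ⟩
      (s ∸ ℓ) * core k       ≤⟨ *-monoˡ-≤ (core k) (∸-monoʳ-≤ s k≤ℓ) ⟩
      (s ∸ k) * core k       ≤⟨ outflow-bound k ⟩
      suc k * outflow k      ≤⟨ *-monoˡ-≤ (outflow k) (s≤s k≤ℓ) ⟩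
      suc ℓ * outflow k      ∎)
      where
      open ≤-Reasoning
      reassoc : ∀ ℓ g → suc ℓ * (2 * g) ≡ 2 * (ℓ + 1) * g
      reassoc = solve-∀

    outflow<2*leak : ∀ k → k ≤ ℓ → outflow k < 2 * leak k
    outflow<2*leak k k≤ℓ = +-cancelˡ-< (outflow k) (outflow k) (2 * leak k) (begin-strict
      outflow k + outflow k     ≡⟨ cong (outflow k +_) (+-identityʳ (outflow k)) ⟨
      2 * outflow k             ≤⟨ *-monoʳ-≤ 2 (outflow-split k) ⟩
      2 * (image k + leak k)    ≡⟨ *-distribˡ-+ 2 (image k) (leak k) ⟩
      2 * image k + 2 * leak k  <⟨ +-monoˡ-< (2 * leak k) (2*image<outflow k k≤ℓ) ⟩
      outflow k + 2 * leak k    ∎)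
      where open ≤-Reasoning

    -- The weight 2ᵏ (k!)² makes the growth of core along non-expanding levels telescope.
    weighted : ℕ → ℕ
    weighted k = core k * (2 ^ k * (k ! * k !))

    weighted-grows : ∀ k → k ≤ ℓ → (s ∸ k) * weighted k < weighted (suc k)
    weighted-grows k k≤ℓ = begin-strict
      (s ∸ k) * (core k * w)                    ≡⟨ *-assoc (s ∸ k) (core k) w ⟨
      (s ∸ k) * core k * w                      <⟨ *-monoˡ-< w step ⟩
      suc k * (2 * (suc k * core (suc k))) * w  ≡⟨ regroup (suc k) (core (suc k)) (2 ^ k) (k !) ⟩
      weighted (suc k)                          ∎
      where
      open ≤-Reasoning
      w : ℕ
      w = 2 ^ k * (k ! * k !)
      instance
        w≢0 : NonZero w
        w≢0 = m*n≢0 (2 ^ k) (k ! * k !) {{m^n≢0 2 k}} {{k !* k !≢0}}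
      step : (s ∸ k) * core k < suc k * (2 * (suc k * core (suc k)))
      step = ≤-<-trans (outflow-bound k) (*-monoʳ-< (suc k) (<-≤-trans (outflow<2*leak k k≤ℓ) (*-monoʳ-≤ 2 (leak-bound k))))
      regroup : ∀ K b p f → K * (2 * (K * b)) * (p * (f * f)) ≡ b * ((2 * p) * ((K * f) * (K * f)))
      regroup = solve-∀

    fallingFactorial≤weighted : ∀ j → j ≤ suc ℓ → s P′ j ≤ weighted j
    fallingFactorial≤weighted zero _ = ≤-trans core₀-nonempty (≤-reflexive (sym (*-identityʳ (core 0))))
    fallingFactorial≤weighted (suc j) (s≤s j≤ℓ) =
      ≤-trans (*-monoʳ-≤ (s ∸ j) (fallingFactorial≤weighted j (m≤n⇒m≤1+n j≤ℓ))) (<⇒≤ (weighted-grows j j≤ℓ))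

    stalling-impossible : ⊥
    stalling-impossible = <-irrefl refl (begin-strict
      s P′ suc L                   ≡⟨⟩
      (s ∸ L) * (s P′ L)           <⟨ *-monoʳ-< (s ∸ L) {{s∸L≢0}} P′<weighted ⟩
      (s ∸ L) * (core L * w)       ≡⟨ *-assoc (s ∸ L) (core L) w ⟨
      (s ∸ L) * core L * w         ≤⟨ *-monoˡ-≤ w (outflow-bound L) ⟩
      suc L * outflow L * w        ≤⟨ *-monoˡ-≤ w (*-monoʳ-≤ (suc L) (outflow≤N L)) ⟩
      suc L * N * w                ≡⟨ regroup (suc L) N (2 ^ L) (L !) ⟩
      N * (2 ^ L * L !) * suc L !  ≤⟨ *-monoˡ-≤ (suc L !) N-small′ ⟩
      (s C suc L) * suc L !        ≤⟨ nCk*k!≤nP′k s (suc L) L<s ⟩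
      s P′ suc L                   ∎)
      where
      open ≤-Reasoning
      L w : ℕ
      L = suc ℓ
      w = 2 ^ L * (L ! * L !)
      L<s : suc L ≤ s
      L<s = subst (_≤ s) (+-comm ℓ 2) ℓ+2≤s
      s∸L≢0 : NonZero (s ∸ L)
      s∸L≢0 = >-nonZero (m<n⇒0<n∸m L<s)
      N-small′ : N * (2 ^ L * L !) ≤ s C suc L
      N-small′ = subst₂ (λ u v → N * (2 ^ u * u !) ≤ s C v) (+-comm ℓ 1) (+-comm ℓ 2) N-small
      P′<weighted : s P′ L < weighted L
      P′<weighted = ≤-<-trans (*-monoʳ-≤ (s ∸ ℓ) (fallingFactorial≤weighted ℓ (n≤1+n ℓ))) (weighted-grows ℓ ≤-refl)
      regroup : ∀ K n p f → K * n * (p * (f * f)) ≡ n * (p * f) * (K * f)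
      regroup = solve-∀

  some-level-expands : Σ ℕ λ k → k ≤ ℓ × Expands k
  some-level-expands with anyUpTo? (λ k → (s ∸ ℓ) * core k ≤? 2 * (ℓ + 1) * image k) (suc ℓ)
  ... | yes (k , s≤s k≤ℓ , expands) = k , k≤ℓ , expands
  ... | no none = ⊥-elim (stalling-impossible (λ k k≤ℓ expands → none (k , s≤s k≤ℓ , expands)))

-- Clusters around a point

module Cluster {s : ℕ} (E F : List (Pt s)) (E-unique : Unique E) (F-unique : Unique F)
  (𝒪E⊆F : ∀ {y} → y ∈ E → (i : Fin s) → (y +e i) ∈ F) (x : Pt s) where

  _≟ᵥ_ : DecidableEquality (Pt s)
  _≟ᵥ_ = ≡-dec ℤ._≟_

  open import Data.List.Membership.DecPropositional _≟ᵥ_ using (_∈?_)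

  δ : Pt s → Pt s
  δ y = y -ᵥ x

  δ-+e : ∀ y i → δ (y +e i) ≡ δ y +e i
  δ-+e y i = -ᵥ-+e y x i

  δ-pred : ∀ f i → δ f ≡ δ (f -e i) +e i
  δ-pred f i = trans (cong δ (sym (-e-+e f i))) (δ-+e (f -e i) i)

  Near : ℕ → Pt s → Set
  Near k y = InCᵖ k (δ y)

  near? : ∀ k → Decidable (Near k)
  near? k y = InCᵖ? k (δ y)

  -- Core k = E ∩ C_k(x) and Outflow k = F ∩ 𝒪(Core k); Image k is the part F_k split off with Core k.
  Core Rest : ℕ → List (Pt s)
  Core k = filter (near? k) E
  Rest k = filter (∁? (near? k)) E

  HasPredIn : List (Pt s) → Pt s → Set
  HasPredIn L f = Σ (Fin s) λ i → (f -e i) ∈ L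

  hasPredIn? : ∀ L → Decidable (HasPredIn L)
  hasPredIn? L f = Fin.any? (λ i → (f -e i) ∈? L)

  Captured Shared : ℕ → Pt s → Set
  Captured k f = HasPredIn (Core k) f × ¬ HasPredIn (Rest k) f
  Shared k f = HasPredIn (Core k) f × HasPredIn (Rest k) f

  captured? : ∀ k → Decidable (Captured k)
  captured? k f = hasPredIn? (Core k) f ×-dec ¬? (hasPredIn? (Rest k) f)

  shared? : ∀ k → Decidable (Shared k)
  shared? k f = hasPredIn? (Core k) f ×-dec hasPredIn? (Rest k) f

  Outflow Image Leak : ℕ → List (Pt s)
  Outflow k = filter (hasPredIn? (Core k)) F
  Image k = filter (captured? k) F
  Leak k = filter (shared? k) F

  -- Steps with b = false raise posSum ∘ δ by one ("up"), those with b = true leave it unchanged ("down").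
  Step : Bool → Pt s → Pt s → Set
  Step b y f = Σ (Fin s) λ i → isNegative (lookup (δ y) i) ≡ b × f ≡ y +e i

  step? : ∀ b y f → Dec (Step b y f)
  step? b y f = Fin.any? λ i → (isNegative (lookup (δ y) i) Bool.≟ b) ×-dec (f ≟ᵥ (y +e i))

  core⇒near : ∀ {k y} → y ∈ Core k → Near k y
  core⇒near y∈ = proj₂ (∈-filter⁻ (near? _) {xs = E} y∈)

  core⊆E : ∀ {k y} → y ∈ Core k → y ∈ E
  core⊆E y∈ = proj₁ (∈-filter⁻ (near? _) {xs = E} y∈)

  up-successors : ∀ k {a} → a ∈ Core k → s ∸ k ≤ length (filter (step? false a) (Outflow k))
  up-successors k {a} a∈ = begin
    s ∸ k                  ≤⟨ ∸-monoʳ-≤ s (≤-trans (#negatives≤posSum (δ a) (proj₁ near)) (proj₂ near)) ⟩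
    s ∸ length negatives   ≡⟨ cong (_∸ length negatives) (length-indicesWhere-not isNegative (δ a)) ⟨
    length negatives + length nonnegatives ∸ length negatives ≡⟨ m+n∸m≡n (length negatives) (length nonnegatives) ⟩
    length nonnegatives    ≡⟨ length-map (a +e_) nonnegatives ⟨
    length (map (a +e_) nonnegatives)
      ≤⟨ Unique-⊆⇒length≤ (Unique.map⁺ (+e-injective a) (indicesWhere-Unique _ (δ a))) successor∈ ⟩
    length (filter (step? false a) (Outflow k)) ∎
    where
    open ≤-Reasoning
    near : Near k a
    near = core⇒near a∈
    negatives nonnegatives : List (Fin s)
    negatives = indicesWhere isNegative (δ a)
    nonnegatives = indicesWhere (not ∘ isNegative) (δ a)
    successor∈ : ∀ {f} → f ∈ map (a +e_) nonnegatives → f ∈ filter (step? false a) (Outflow k)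
    successor∈ f∈ with i , i∈ , refl ← ∈-map⁻ (a +e_) f∈ =
      ∈-filter⁺ (step? false a)
        (∈-filter⁺ (hasPredIn? (Core k)) (𝒪E⊆F (core⊆E a∈) i) (i , subst (_∈ Core k) (sym (+e--e a i)) a∈))
        (i , not-injective (∈-indicesWhere⁻ _ (δ a) i∈) , refl)

  up-predecessors : ∀ k {f} → f ∈ Outflow k → length (filter (λ a → step? false a f) (Core k)) ≤ suc k
  up-predecessors k {f} f∈ with _ , (i , pred∈) ← ∈-filter⁻ (hasPredIn? (Core k)) {xs = F} f∈ = begin
    length (filter (λ a → step? false a f) (Core k))
      ≤⟨ Unique-⊆⇒length≤ (Unique.filter⁺ _ (Unique.filter⁺ (near? k) E-unique)) predecessor∈ ⟩
    length (map (f -e_) positives)   ≡⟨ length-map (f -e_) positives ⟩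
    length positives                 ≤⟨ #positives≤posSum (δ f) ⟩
    posSum (δ f)                     ≡⟨ cong posSum (δ-pred f i) ⟩
    posSum (δ (f -e i) +e i)         ≤⟨ posSum-+e-≤ (δ (f -e i)) i ⟩
    suc (posSum (δ (f -e i)))        ≤⟨ s≤s (proj₂ (core⇒near pred∈)) ⟩
    suc k                            ∎
    where
    open ≤-Reasoning
    positives : List (Fin s)
    positives = indicesWhere isPositive (δ f)
    predecessor∈ : ∀ {a} → a ∈ filter (λ a → step? false a f) (Core k) → a ∈ map (f -e_) positives
    predecessor∈ {a} a∈ with _ , (j , δaⱼ≥0 , refl) ← ∈-filter⁻ (λ a → step? false a f) {xs = Core k} a∈ =
      subst (_∈ map ((a +e j) -e_) positives) (+e--e a j)
        (∈-map⁺ ((a +e j) -e_) (∈-indicesWhere⁺ isPositive (δ (a +e j))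
          (subst (λ v → isPositive (lookup v j) ≡ true) (sym (δ-+e a j)) (isPositive-+e (δ a) j δaⱼ≥0))))

  -- y lies exactly at level k + 1: above k as y ∉ Core k while δ y ∈ U, at most k + 1 as f is one
  -- step from Core k. Hence the step from y to f cannot go up.
  leak⇒down : ∀ k {f} → f ∈ Leak k → Σ (Pt s) λ y → y ∈ Core (suc k) × Step true y f
  leak⇒down k {f} f∈ with ∈-filter⁻ (shared? k) {xs = F} f∈
  ... | _ , (i , a∈) , (j , y∈) = y , ∈-filter⁺ (near? (suc k)) y∈E (δy∈U , δy≤1+k) , (j , δyⱼ<0 , sym (-e-+e f j))
    where
    a y : Pt s
    a = f -e i
    y = f -e j
    y∈E : y ∈ E
    y∈E = proj₁ (∈-filter⁻ (∁? (near? k)) {xs = E} y∈)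
    y-far : ¬ Near k y
    y-far = proj₂ (∈-filter⁻ (∁? (near? k)) {xs = E} y∈)
    δy∈U : coordSum (δ y) ≡ ℤ.0ℤ
    δy∈U = ∙-cancelʳ ℤ.1ℤ (coordSum (δ y)) ℤ.0ℤ (begin
      coordSum (δ y) ℤ.+ ℤ.1ℤ  ≡⟨ coordSum-+e (δ y) j ⟨
      coordSum (δ y +e j)      ≡⟨ cong coordSum (δ-pred f j) ⟨
      coordSum (δ f)           ≡⟨ cong coordSum (δ-pred f i) ⟩
      coordSum (δ a +e i)      ≡⟨ coordSum-+e (δ a) i ⟩
      coordSum (δ a) ℤ.+ ℤ.1ℤ  ≡⟨ cong (ℤ._+ ℤ.1ℤ) (proj₁ (core⇒near a∈)) ⟩
      ℤ.0ℤ ℤ.+ ℤ.1ℤ            ∎)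
      where open ≡-Reasoning
    δf≤1+k : posSum (δ f) ≤ suc k
    δf≤1+k = begin
      posSum (δ f)               ≡⟨ cong posSum (δ-pred f i) ⟩
      posSum (δ a +e i)          ≤⟨ posSum-+e-≤ (δ a) i ⟩
      suc (posSum (δ a))         ≤⟨ s≤s (proj₂ (core⇒near a∈)) ⟩
      suc k                      ∎
      where open ≤-Reasoning
    δy≤1+k : posSum (δ y) ≤ suc k
    δy≤1+k = ≤-trans (≤-trans (posSum-≤-+e (δ y) j) (≤-reflexive (cong posSum (sym (δ-pred f j))))) δf≤1+k
    δyⱼ<0 : isNegative (lookup (δ y) j) ≡ true
    δyⱼ<0 with isNegative (lookup (δ y) j) in δyⱼ
    ... | true = refl
    ... | false = ⊥-elim (<-irrefl refl (begin-strict
      suc k                      <⟨ s≤s (≰⇒> (λ δy≤k → y-far (δy∈U , δy≤k))) ⟩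
      suc (posSum (δ y))         ≡⟨ posSum-+e-nonneg (δ y) j δyⱼ ⟨
      posSum (δ y +e j)          ≡⟨ cong posSum (δ-pred f j) ⟨
      posSum (δ f)               ≤⟨ δf≤1+k ⟩
      suc k                      ∎))
      where open ≤-Reasoning

  down-successors : ∀ k {y} → y ∈ Core (suc k) → length (filter (step? true y) (Leak k)) ≤ suc k
  down-successors k {y} y∈ = begin
    length (filter (step? true y) (Leak k))
      ≤⟨ Unique-⊆⇒length≤ (Unique.filter⁺ _ (Unique.filter⁺ (shared? k) F-unique)) successor∈ ⟩
    length (map (y +e_) negatives)   ≡⟨ length-map (y +e_) negatives ⟩
    length negatives                 ≤⟨ #negatives≤posSum (δ y) (proj₁ (core⇒near y∈)) ⟩
    posSum (δ y)                     ≤⟨ proj₂ (core⇒near y∈) ⟩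
    suc k                            ∎
    where
    open ≤-Reasoning
    negatives : List (Fin s)
    negatives = indicesWhere isNegative (δ y)
    successor∈ : ∀ {f} → f ∈ filter (step? true y) (Leak k) → f ∈ map (y +e_) negatives
    successor∈ f∈ with _ , (j , δyⱼ<0 , refl) ← ∈-filter⁻ (step? true y) {xs = Leak k} f∈ =
      ∈-map⁺ (y +e_) (∈-indicesWhere⁺ isNegative (δ y) δyⱼ<0)

  outflow-bound : ∀ k → (s ∸ k) * length (Core k) ≤ suc k * length (Outflow k)
  outflow-bound k = double-counting (step? false) (Core k) (Outflow k) (up-successors k) (up-predecessors k)

  outflow-split : ∀ k → length (Outflow k) ≤ length (Image k) + length (Leak k)
  outflow-split k = length-filter-⊎ (hasPredIn? (Core k)) (captured? k) (shared? k) split F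
    where
    split : ∀ {f} → HasPredIn (Core k) f → Captured k f ⊎ Shared k f
    split {f} p with hasPredIn? (Rest k) f
    ... | yes q = inj₂ (p , q)
    ... | no ¬q = inj₁ (p , ¬q)

  leak-bound : ∀ k → length (Leak k) ≤ suc k * length (Core (suc k))
  leak-bound k = subst (_≤ suc k * length (Core (suc k))) (*-identityˡ (length (Leak k)))
    (double-counting (λ f y → step? true y f) (Leak k) (Core (suc k)) has-down-predecessor (down-successors k))
    where
    has-down-predecessor : ∀ {f} → f ∈ Leak k → 1 ≤ length (filter (λ y → step? true y f) (Core (suc k)))
    has-down-predecessor f∈ with y , y∈ , step ← leak⇒down k f∈ =
      Unique-⊆⇒length≤ {L = [ y ]} (All.[] ∷ []) λ { (here refl) → ∈-filter⁺ (λ y → step? true y _) y∈ step }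

  select-level : x ∈ E → ∀ {ℓ} → ℓ + 2 ≤ s → length F * (2 ^ (ℓ + 1) * (ℓ + 1) !) ≤ s C (ℓ + 2) →
    Σ ℕ λ k → k ≤ ℓ × (s ∸ ℓ) * length (Core k) ≤ 2 * (ℓ + 1) * length (Image k)
  select-level x∈E = some-level-expands (length ∘ Core) (length ∘ Outflow) (length ∘ Image) (length ∘ Leak)
    outflow-bound outflow-split leak-bound (λ k → length-filter (hasPredIn? (Core k)) F) x∈Core₀
    where
    x∈Core₀ : 1 ≤ length (Core 0)
    x∈Core₀ = Unique-⊆⇒length≤ {L = [ x ]} (All.[] ∷ []) λ { (here refl) → ∈-filter⁺ (near? 0) x∈E (InCᵖ-self 0 x) }

  core⊆C : ∀ {k ℓ} → k ≤ ℓ → Core k ⊆ InC ℓ x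
  core⊆C {k} {ℓ} k≤ℓ {y} y∈ with δy∈U , δy≤k ← core⇒near y∈ = InCᵖ⇒InC ℓ x y (δy∈U , ≤-trans δy≤k k≤ℓ)

  image⊆𝒪 : ∀ k → Image k ⊆ InO (Core k)
  image⊆𝒪 k {f} f∈ with _ , (i , pred∈) , _ ← ∈-filter⁻ (captured? k) {xs = F} f∈ =
    f -e i , pred∈ , i , sym (-e-+e f i)

  Remaining : ℕ → List (Pt s)
  Remaining k = filter (∁? (captured? k)) F

  𝒪Rest⊆Remaining : ∀ k {y} → y ∈ Rest k → (i : Fin s) → (y +e i) ∈ Remaining k
  𝒪Rest⊆Remaining k {y} y∈ i = ∈-filter⁺ (∁? (captured? k)) (𝒪E⊆F (proj₁ (∈-filter⁻ (∁? (near? k)) {xs = E} y∈)) i)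
    λ (_ , no-pred-in-Rest) → no-pred-in-Rest (i , subst (_∈ Rest k) (sym (+e--e y i)) y∈)

  Rest-shorter : x ∈ E → ∀ k → length (Rest k) < length E
  Rest-shorter x∈E k = filter-notAll (∁? (near? k)) E (Any.map (λ { refl x-far → x-far (InCᵖ-self k x) }) x∈E)

-- Decompositions

record Decomposition {s : ℕ} (ℓ : ℕ) (E F : List (Pt s)) : Set where
  field
    r : ℕ
    centres : Vec (Pt s) r
    parts images : Vec (List (Pt s)) r
    rest : List (Pt s)
    centre∈E : ∀ i → lookup centres i ∈ E
    parts↭E : concat (toList parts) ↭ E
    images↭F : (concat (toList images) ++ rest) ↭ F
    parts⊆C : ∀ i → lookup parts i ⊆ InC ℓ (lookup centres i)
    images⊆𝒪 : ∀ i → lookup images i ⊆ InO (lookup parts i)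
    parts-expand : ∀ i → (s ∸ ℓ) * length (lookup parts i) ≤ 2 * (ℓ + 1) * length (lookup images i)

empty-decomposition : ∀ {s ℓ} (F : List (Pt s)) → Decomposition ℓ [] F
empty-decomposition F = record
  { r = 0 ; centres = [] ; parts = [] ; images = [] ; rest = F
  ; centre∈E = λ () ; parts↭E = ↭-refl ; images↭F = ↭-refl
  ; parts⊆C = λ () ; images⊆𝒪 = λ () ; parts-expand = λ () }

add-cluster : ∀ {s ℓ} {E F E′ F′ A I : List (Pt s)} {x : Pt s} →
  x ∈ E → A ++ E′ ↭ E → I ++ F′ ↭ F → A ⊆ InC ℓ x → I ⊆ InO A →
  (s ∸ ℓ) * length A ≤ 2 * (ℓ + 1) * length I →
  Decomposition ℓ E′ F′ → Decomposition ℓ E F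
add-cluster {E = E} {E′ = E′} {A = A} {I} {x} x∈E A++E′↭E I++F′↭F A⊆C I⊆𝒪 A-expands D = record
  { r = suc r
  ; centres = x ∷ centres
  ; parts = A ∷ parts
  ; images = I ∷ images
  ; rest = rest
  ; centre∈E = λ { Fin.zero → x∈E ; (Fin.suc i) → E′⊆E (centre∈E i) }
  ; parts↭E = ↭-trans (++⁺ˡ A parts↭E) A++E′↭E
  ; images↭F = ↭-trans (↭-reflexive (++-assoc I (concat (toList images)) rest)) (↭-trans (++⁺ˡ I images↭F) I++F′↭F)
  ; parts⊆C = λ { Fin.zero → A⊆C ; (Fin.suc i) → parts⊆C i }
  ; images⊆𝒪 = λ { Fin.zero → I⊆𝒪 ; (Fin.suc i) → images⊆𝒪 i }
  ; parts-expand = λ { Fin.zero → A-expands ; (Fin.suc i) → parts-expand i }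
  }
  where
  open Decomposition D
  E′⊆E : ∀ {y} → y ∈ E′ → y ∈ E
  E′⊆E y∈E′ = ∈-resp-↭ A++E′↭E (∈-++⁺ʳ A y∈E′)

concat-expansion : ∀ {A : Set} {r} c d (Es Fs : Vec (List A) r) →
  (∀ i → c * length (lookup Es i) ≤ d * length (lookup Fs i)) →
  c * length (concat (toList Es)) ≤ d * length (concat (toList Fs))
concat-expansion c d [] [] _ = ≤-trans (≤-reflexive (*-zeroʳ c)) z≤n
concat-expansion c d (E ∷ Es) (F ∷ Fs) expands = begin
  c * length (E ++ concat (toList Es))               ≡⟨ cong (c *_) (length-++ E) ⟩
  c * (length E + length (concat (toList Es)))       ≡⟨ *-distribˡ-+ c (length E) _ ⟩
  c * length E + c * length (concat (toList Es))     ≤⟨ +-mono-≤ (expands Fin.zero) (concat-expansion c d Es Fs (expands ∘ Fin.suc)) ⟩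
  d * length F + d * length (concat (toList Fs))     ≡⟨ *-distribˡ-+ d (length F) _ ⟨
  d * (length F + length (concat (toList Fs)))       ≡⟨ cong (d *_) (length-++ F) ⟨
  d * length (F ++ concat (toList Fs))               ∎
  where open ≤-Reasoning

module _ {s ℓ : ℕ} {E F : List (Pt s)} (D : Decomposition ℓ E F) where

  open Decomposition D

  total-expansion : (s ∸ ℓ) * length E ≤ 2 * (ℓ + 1) * length F
  total-expansion = begin
    (s ∸ ℓ) * length E                                    ≡⟨ cong ((s ∸ ℓ) *_) (↭-length parts↭E) ⟨
    (s ∸ ℓ) * length (concat (toList parts))              ≤⟨ concat-expansion (s ∸ ℓ) (2 * (ℓ + 1)) parts images parts-expand ⟩
    2 * (ℓ + 1) * length (concat (toList images))         ≤⟨ *-monoʳ-≤ (2 * (ℓ + 1)) (length-++-≤ˡ (concat (toList images))) ⟩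
    2 * (ℓ + 1) * length (concat (toList images) ++ rest) ≡⟨ cong (2 * (ℓ + 1) *_) (↭-length images↭F) ⟩
    2 * (ℓ + 1) * length F                                ∎
    where open ≤-Reasoning

  nonempty⇒1≤r : E ≢ [] → 1 ≤ r
  nonempty⇒1≤r E≢[] with r | parts | parts↭E
  ... | zero | [] | []↭E = ⊥-elim (E≢[] (↭-empty-inv (↭-sym []↭E)))
  ... | suc _ | _ | _ = s≤s z≤n

decompose : ∀ {s ℓ} → ℓ + 2 ≤ s → (E F : List (Pt s)) → Acc _<_ (length E) → Unique E → Unique F →
  (∀ {y} → y ∈ E → (i : Fin s) → (y +e i) ∈ F) →
  length F * (2 ^ (ℓ + 1) * (ℓ + 1) !) ≤ s C (ℓ + 2) → Decomposition ℓ E F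
decompose _ [] F _ _ _ _ _ = empty-decomposition F
decompose {s} {ℓ} ℓ+2≤s E@(x ∷ _) F (acc smaller) E-unique F-unique 𝒪E⊆F F-small =
  split-off (select-level (here refl) ℓ+2≤s F-small)
  where
  open Cluster E F E-unique F-unique 𝒪E⊆F x
  split-off : Σ ℕ (λ k → k ≤ ℓ × (s ∸ ℓ) * length (Core k) ≤ 2 * (ℓ + 1) * length (Image k)) → Decomposition ℓ E F
  split-off (k , k≤ℓ , expands) =
    add-cluster (here refl) (filter-++-filter∁-↭ (near? k) E) (filter-++-filter∁-↭ (captured? k) F)
      (core⊆C k≤ℓ) (image⊆𝒪 k) expands
      (decompose ℓ+2≤s (Rest k) (Remaining k) (smaller (Rest-shorter (here refl) k))
        (Unique.filter⁺ (∁? (near? k)) E-unique) (Unique.filter⁺ (∁? (captured? k)) F-unique) (𝒪Rest⊆Remaining k)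
        (≤-trans (*-monoˡ-≤ _ (length-filter (∁? (captured? k)) F)) F-small))

proposition6p2 : (s ℓ : ℕ) → 1 ≤ s → ℓ + 2 ≤ s →
    (E F : List (Pt s)) → Unique E → Unique F →
    (∀ {x} → x ∈ E → (i : Fin s) → (x +e i) ∈ F) →
    length F * (2 ^ (ℓ + 1) * (ℓ + 1) !) ≤ s C (ℓ + 2) →
    ((s ∸ ℓ) * length E ≤ 2 * (ℓ + 1) * length F)
    × (E ≢ [] →
       Σ ℕ λ r → 1 ≤ r ×
       Σ (Vec (Pt s) r) λ xs →
       Σ (Vec (List (Pt s)) r) λ Es →
       Σ (Vec (List (Pt s)) r) λ Fs →
       Σ (List (Pt s)) λ Fextra →
         (∀ i → lookup xs i ∈ E)
         × (concat (toList Es) ↭ E)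
         × ((concat (toList Fs) ++ Fextra) ↭ F)
         × (∀ i → lookup Es i ⊆ InC ℓ (lookup xs i))
         × (∀ i → lookup Fs i ⊆ InO (lookup Es i))
         × (∀ i → (s ∸ ℓ) * length (lookup Es i) ≤ 2 * (ℓ + 1) * length (lookup Fs i)))
proposition6p2 s ℓ _ ℓ+2≤s E F E-unique F-unique 𝒪E⊆F F-small =
  total-expansion D ,
  λ E≢[] → r , nonempty⇒1≤r D E≢[] , centres , parts , images , rest ,
           centre∈E , parts↭E , images↭F , parts⊆C , images⊆𝒪 , parts-expand
  where
  D : Decomposition ℓ E F
  D = decompose ℓ+2≤s E F (<-wellFounded (length E)) E-unique F-unique 𝒪E⊆F F-small
  open Decomposition D
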